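{- The class $\mathcal{S}$ of small maps in $\mathbb{DCL}[ZF]$ is stable under pullback: if $f\in\mathcal{S}$ and $f'$ is a pullback of $f$ in $\mathbb{DCL}[ZF]$ along some arrow, then $f'\in\mathcal{S}$.
   Context: $ZF$ is Zermelo–Fraenkel set theory (classical first-order theory with equality, language with one binary relation symbol $\in$). The syntactic category $\mathbb{ZF}$ has as objects formulas in context $\{x_1,\dots,x_n\mid P\}$ ($x_i$ distinct variables, possibly none, $P$ a formula with free variables among them); an arrow $\{\mathbf{x}\mid P\}\to\{\mathbf{y}\mid Q\}$ is an equivalence class $[\{\mathbf{x}',\mathbf{y}'\mid F\}]_{\equiv}$ of formulas in context ($\mathbf{x}',\mathbf{y}'$ of the same lengths as $\mathbf{x},\mathbf{y}$) with $F\vdash_{ZF}P[\mathbf{x}'/\mathbf{x}]\wedge Q[\mathbf{y}'/\mathbf{y}]$, $F\wedge F[\mathbf{y}''/\mathbf{y}']\vdash_{ZF}\mathbf{y}'=\mathbf{y}''$, $P[\mathbf{x}'/\mathbf{x}]\vdash_{ZF}\exists\mathbf{y}'F$, two such being equivalent iff $\vdash_{ZF}F\leftrightarrow F'[\mathbf{x}'/\mathbf{x}'',\mathbf{y}'/\mathbf{y}'']$; composition of $[\{\mathbf{x}',\mathbf{y}'\mid F\}]$ and $[\{\mathbf{y}',\mathbf{z}'\mid F'\}]$ (all variables distinct) is $[\{\mathbf{x}',\mathbf{z}'\mid\exists\mathbf{y}'(F\wedge F')\}]$. $\mathbb{DCL}[ZF]$ is the full subcategory of $\mathbb{ZF}$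 on objects $\{x\mid P\}$ with exactly one variable. The class $\mathcal{S}$ of small maps in $\mathbb{DCL}[ZF]$: an arrow $[\{x,y\mid F\}]_{\equiv}:\{x\mid P\}\to\{y\mid Q\}$ is in $\mathcal{S}$ iff $\vdash_{ZF}\forall y\exists z\forall x(F(x,y)\leftrightarrow x\in z)$. -}

module Defs where

open import Data.Nat using (ℕ; zero; suc)
open import Data.Fin using (Fin; zero; suc; #_; _↑ʳ_)
open import Data.List using (List; []; _∷_; map)
open import Data.List.Membership.Propositional using (_∈_)
open import Data.Product using (Σ; _×_)

-- First-order language of set theory (one binary relation symbol ∈,
-- plus equality), with de Bruijn variables: Fm n = formulas whose free
-- variables are among n variables (a "formula in context" of length n,
-- modulo α-renaming).  Variable 0 is the most recently bound one.

infixr 4 _⇒_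
infixr 5 _∨'_
infixr 6 _∧'_
infix 7 _∈'_ _≐_

data Fm (n : ℕ) : Set where
  _∈'_ : Fin n → Fin n → Fm n
  _≐_  : Fin n → Fin n → Fm n
  ⊥'   : Fm n
  _⇒_  : Fm n → Fm n → Fm n
  _∧'_ : Fm n → Fm n → Fm n
  _∨'_ : Fm n → Fm n → Fm n
  ∀'   : Fm (suc n) → Fm n
  ∃'   : Fm (suc n) → Fm n

¬' : ∀ {n} → Fm n → Fm n
¬' φ = φ ⇒ ⊥'

infix 3 _⇔_
_⇔_ : ∀ {n} → Fm n → Fm n → Fm n
φ ⇔ ψ = (φ ⇒ ψ) ∧' (ψ ⇒ φ)

lift : ∀ {m n} → (Fin m → Fin n) → Fin (suc m) → Fin (suc n)
lift ρ zero    = zero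
lift ρ (suc i) = suc (ρ i)

rename : ∀ {m n} → (Fin m → Fin n) → Fm m → Fm n
rename ρ (i ∈' j) = ρ i ∈' ρ j
rename ρ (i ≐ j)  = ρ i ≐ ρ j
rename ρ ⊥'       = ⊥'
rename ρ (φ ⇒ ψ)  = rename ρ φ ⇒ rename ρ ψ
rename ρ (φ ∧' ψ) = rename ρ φ ∧' rename ρ ψ
rename ρ (φ ∨' ψ) = rename ρ φ ∨' rename ρ ψ
rename ρ (∀' φ)   = ∀' (rename (lift ρ) φ)
rename ρ (∃' φ)   = ∃' (rename (lift ρ) φ)

_▹_ : ∀ {k n} → Fin n → (Fin k → Fin n) → Fin (suc k) → Fin n
(a ▹ ρ) zero    = a
(a ▹ ρ) (suc i) = ρ i

id' : ∀ {n} → Fin n → Fin n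
id' i = i

wk : ∀ {n} → Fm n → Fm (suc n)
wk = rename suc

_[_] : ∀ {n} → Fm (suc n) → Fin n → Fm n
φ [ t ] = rename (t ▹ id') φ

fromFin0 : ∀ {n} → Fin 0 → Fin n
fromFin0 ()

∀* : (k : ℕ) → Fm k → Fm 0
∀* zero    φ = φ
∀* (suc k) φ = ∀* k (∀' φ)

-- ∀a ∀b (∀c (c ∈ a ↔ c ∈ b) → a = b)
Extensionality : Fm 0
Extensionality = ∀' (∀' (∀' ((# 0 ∈' # 2) ⇔ (# 0 ∈' # 1)) ⇒ (# 1 ≐ # 0)))

-- ∀a (∃b (b ∈ a) → ∃b (b ∈ a ∧ ¬ ∃c (c ∈ b ∧ c ∈ a)))
Foundation : Fm 0
Foundation = ∀' (∃' (# 0 ∈' # 1)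
                  ⇒ ∃' (# 0 ∈' # 1 ∧' ¬' (∃' (# 0 ∈' # 1 ∧' # 0 ∈' # 2))))

-- ∀a ∀b ∃c (a ∈ c ∧ b ∈ c)
Pairing : Fm 0
Pairing = ∀' (∀' (∃' (# 2 ∈' # 0 ∧' # 1 ∈' # 0)))

-- ∀a ∃u ∀x (∃y (x ∈ y ∧ y ∈ a) → x ∈ u)
Union : Fm 0
Union = ∀' (∃' (∀' (∃' (# 1 ∈' # 0 ∧' # 0 ∈' # 3) ⇒ # 0 ∈' # 1)))

-- ∀a ∃p ∀x (∀y (y ∈ x → y ∈ a) → x ∈ p)
PowerSet : Fm 0
PowerSet = ∀' (∃' (∀' (∀' (# 0 ∈' # 1 ⇒ # 0 ∈' # 3) ⇒ # 0 ∈' # 1)))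

-- ∃w (∃e (e ∈ w ∧ ∀z ¬ z ∈ e) ∧ ∀x (x ∈ w → ∃y (y ∈ w ∧ ∀z (z ∈ y ↔ (z ∈ x ∨ z = x)))))
Infinity : Fm 0
Infinity = ∃' ( ∃' (# 0 ∈' # 1 ∧' ∀' (¬' (# 0 ∈' # 1)))
              ∧' ∀' (# 0 ∈' # 1 ⇒
                     ∃' (# 0 ∈' # 2 ∧'
                         ∀' ((# 0 ∈' # 1) ⇔ (# 0 ∈' # 2 ∨' # 0 ≐ # 2)))))

-- Separation schema, φ(u, p₁..p_k):
-- ∀p ∀X ∃Y ∀u (u ∈ Y ↔ (u ∈ X ∧ φ(u, p)))
Separation : (k : ℕ) → Fm (suc k) → Fm 0
Separation k φ =
  ∀* k (∀' (∃' (∀' ((# 0 ∈' # 1) ⇔ (# 0 ∈' # 2 ∧' rename ((# 0) ▹ (3 ↑ʳ_)) φ)))))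

-- Replacement schema, φ(x, y, p₁..p_k):
-- ∀p ( ∀x ∀y ∀z (φ(x,y,p) ∧ φ(x,z,p) → y = z)
--      → ∀X ∃Y ∀y (y ∈ Y ↔ ∃x (x ∈ X ∧ φ(x,y,p))) )
Replacement : (k : ℕ) → Fm (suc (suc k)) → Fm 0
Replacement k φ =
  ∀* k ( ∀' (∀' (∀' ( rename ((# 2) ▹ ((# 1) ▹ (3 ↑ʳ_))) φ
                      ∧' rename ((# 2) ▹ ((# 0) ▹ (3 ↑ʳ_))) φ
                      ⇒ # 1 ≐ # 0)))
       ⇒ ∀' (∃' (∀' ((# 0 ∈' # 1) ⇔
                     ∃' (# 0 ∈' # 3 ∧' rename ((# 0) ▹ ((# 1) ▹ (4 ↑ʳ_))) φ)))))

data ZFAxiom : Fm 0 → Set where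
  ax-ext  : ZFAxiom Extensionality
  ax-fnd  : ZFAxiom Foundation
  ax-pair : ZFAxiom Pairing
  ax-un   : ZFAxiom Union
  ax-pow  : ZFAxiom PowerSet
  ax-inf  : ZFAxiom Infinity
  ax-sep  : (k : ℕ) (φ : Fm (suc k)) → ZFAxiom (Separation k φ)
  ax-rep  : (k : ℕ) (φ : Fm (suc (suc k))) → ZFAxiom (Replacement k φ)

infix 2 _⊢_

data _⊢_ : {n : ℕ} → List (Fm n) → Fm n → Set where
  hyp  : ∀ {n} {Γ : List (Fm n)} {φ} → φ ∈ Γ → Γ ⊢ φ
  ax   : ∀ {n} {Γ : List (Fm n)} {σ} → ZFAxiom σ → Γ ⊢ rename fromFin0 σ
  ⇒I   : ∀ {n} {Γ : List (Fm n)} {φ ψ} → φ ∷ Γ ⊢ ψ → Γ ⊢ φ ⇒ ψ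
  ⇒E   : ∀ {n} {Γ : List (Fm n)} {φ ψ} → Γ ⊢ φ ⇒ ψ → Γ ⊢ φ → Γ ⊢ ψ
  ∧I   : ∀ {n} {Γ : List (Fm n)} {φ ψ} → Γ ⊢ φ → Γ ⊢ ψ → Γ ⊢ φ ∧' ψ
  ∧E₁  : ∀ {n} {Γ : List (Fm n)} {φ ψ} → Γ ⊢ φ ∧' ψ → Γ ⊢ φ
  ∧E₂  : ∀ {n} {Γ : List (Fm n)} {φ ψ} → Γ ⊢ φ ∧' ψ → Γ ⊢ ψ
  ∨I₁  : ∀ {n} {Γ : List (Fm n)} {φ ψ} → Γ ⊢ φ → Γ ⊢ φ ∨' ψ
  ∨I₂  : ∀ {n} {Γ : List (Fm n)} {φ ψ} → Γ ⊢ ψ → Γ ⊢ φ ∨' ψ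
  ∨E   : ∀ {n} {Γ : List (Fm n)} {φ ψ χ} →
         Γ ⊢ φ ∨' ψ → φ ∷ Γ ⊢ χ → ψ ∷ Γ ⊢ χ → Γ ⊢ χ
  ⊥E   : ∀ {n} {Γ : List (Fm n)} {φ} → Γ ⊢ ⊥' → Γ ⊢ φ
  raa  : ∀ {n} {Γ : List (Fm n)} {φ} → ¬' φ ∷ Γ ⊢ ⊥' → Γ ⊢ φ
  ∀I   : ∀ {n} {Γ : List (Fm n)} {φ : Fm (suc n)} → map wk Γ ⊢ φ → Γ ⊢ ∀' φ
  ∀E   : ∀ {n} {Γ : List (Fm n)} {φ : Fm (suc n)} → Γ ⊢ ∀' φ → (t : Fin n) → Γ ⊢ φ [ t ]
  ∃I   : ∀ {n} {Γ : List (Fm n)} {φ : Fm (suc n)} (t : Fin n) → Γ ⊢ φ [ t ] → Γ ⊢ ∃' φ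
  ∃E   : ∀ {n} {Γ : List (Fm n)} {φ : Fm (suc n)} {ψ} →
         Γ ⊢ ∃' φ → φ ∷ map wk Γ ⊢ wk ψ → Γ ⊢ ψ
  ≐refl  : ∀ {n} {Γ : List (Fm n)} (t : Fin n) → Γ ⊢ t ≐ t
  ≐subst : ∀ {n} {Γ : List (Fm n)} (φ : Fm (suc n)) {s t : Fin n} →
           Γ ⊢ s ≐ t → Γ ⊢ φ [ s ] → Γ ⊢ φ [ t ]

_⊩_ : ∀ {n} → Fm n → Fm n → Set
φ ⊩ ψ = φ ∷ [] ⊢ ψ

⊢ZF : ∀ {n} → Fm n → Set
⊢ZF φ = [] ⊢ φ

-- objects {x | P}: formulas with (at most) one free variable x = #0
Obj : Set
Obj = Fm 1

-- an arrow {x | P} → {y | Q} is represented by F : Fm 2 with x = #0, y = #1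
record Hom (P Q : Obj) : Set where
  field
    F          : Fm 2
    typed      : F ⊩ (rename (λ _ → # 0) P ∧' rename (λ _ → # 1) Q)
    -- context (x, y', y'') = (#0, #1, #2)
    functional : (rename {n = 3} ((# 0) ▹ ((# 1) ▹ fromFin0)) F ∧' rename {n = 3} ((# 0) ▹ ((# 2) ▹ fromFin0)) F)
                 ⊩ (# 1 ≐ # 2)
    -- under ∃y: y = #0, x = #1
    total      : P ⊩ ∃' (rename ((# 1) ▹ ((# 0) ▹ fromFin0)) F)
open Hom public

_≈F_ : Fm 2 → Fm 2 → Set
F ≈F G = ⊢ZF (F ⇔ G)

_≈_ : ∀ {P Q} → Hom P Q → Hom P Q → Set
f ≈ g = F f ≈F F g

-- formula of the composite: F : x → y, G : y → z gives ∃y (F ∧ G) in (x, z).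
-- Inside ∃y: y = #0, x = #1, z = #2.
compF : Fm 2 → Fm 2 → Fm 2
compF F G = ∃' (rename ((# 1) ▹ ((# 0) ▹ fromFin0)) F ∧' rename ((# 0) ▹ ((# 2) ▹ fromFin0)) G)

_∘F_ : ∀ {P Q R} → Hom Q R → Hom P Q → Fm 2
g ∘F f = compF (F f) (F g)

-- The square   D --p--> A
--              |        |
--             f'        f
--              v        v
--              B --g--> C     is a pullback in DCL[ZF]
record IsPullback {A B C D : Obj} (f : Hom A C) (g : Hom B C)
                  (p : Hom D A) (f' : Hom D B) : Set where
  field
    commutes  : (f ∘F p) ≈F (g ∘F f')
    universal : (E : Obj) (h : Hom E A) (k : Hom E B) →
                (f ∘F h) ≈F (g ∘F k) →
                Σ (Hom E D) λ u →
                  ((p ∘F u) ≈F F h) × ((f' ∘F u) ≈F F k) ×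
                  ((v : Hom E D) → (p ∘F v) ≈F F h → (f' ∘F v) ≈F F k → v ≈ u)

-- small maps: ⊢ ∀y ∃z ∀x (F(x, y) ↔ x ∈ z)   (inside: x = #0, z = #1, y = #2)
Small : ∀ {P Q} → Hom P Q → Set
Small f = ⊢ZF (∀' (∃' (∀' (rename {n = 3} ((# 0) ▹ ((# 2) ▹ fromFin0)) (F f) ⇔ (# 0 ∈' # 1)))))

-- The one property of a pullback square used is that its legs p and f' are jointly
-- monic.  For this take the kernel pair K = {⟨x₁, x₂⟩ | p x₁ = p x₂ ∧ f' x₁ = f' x₂}
-- (Kuratowski pairs) with its two projections π₁, π₂ : K → D: the cones (p ∘ π₁, f' ∘ π₁)
-- and (p ∘ π₂, f' ∘ π₂) coincide, so uniqueness in the universal property forces π₁ = π₂.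
-- Then, for y with g y = c, the fibre of f' over y is the image of the set f⁻¹(c) under
-- a ↦ (the x with p x = a and f' x = y), which is functional by joint monicity, hence a
-- set by Replacement; if y has no g-image the fibre is empty.
module Submission where

open import Defs
open import Data.Fin using (Fin; zero; suc; #_; _↑ʳ_)
open import Data.List using (List; []; _∷_; map; length; lookup)
open import Data.List.Properties using (map-∘; map-cong)
open import Data.List.Membership.Propositional using (_∈_)
open import Data.List.Membership.Propositional.Properties using (∈-map⁺; ∈-lookup)
open import Data.List.Relation.Binary.Subset.Propositional using (_⊆_)
open import Data.List.Relation.Binary.Subset.Propositional.Properties using (map⁺; ∷⁺ʳ; xs⊆ys++xs)
open import Data.List.Relation.Unary.Any using (here; there)
open import Data.Nat using (ℕ; suc; _+_; _≤?_)
open import Data.Product using (Σ; proj₂)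
open import Function using (_∘_; id)
open import Relation.Nullary.Decidable using (True)
open import Relation.Binary.PropositionalEquality
  using (_≡_; _≗_; refl; sym; trans; cong; cong₂; subst; subst₂)

-- Renaming

lift-cong : ∀ {m n} {ρ σ : Fin m → Fin n} → ρ ≗ σ → lift ρ ≗ lift σ
lift-cong e zero    = refl
lift-cong e (suc i) = cong suc (e i)

rename-cong : ∀ {m n} {ρ σ : Fin m → Fin n} → ρ ≗ σ → rename ρ ≗ rename σ
rename-cong e (i ∈' j) = cong₂ _∈'_ (e i) (e j)
rename-cong e (i ≐ j)  = cong₂ _≐_ (e i) (e j)
rename-cong e ⊥'       = refl
rename-cong e (φ ⇒ ψ)  = cong₂ _⇒_ (rename-cong e φ) (rename-cong e ψ)
rename-cong e (φ ∧' ψ) = cong₂ _∧'_ (rename-cong e φ) (rename-cong e ψ)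
rename-cong e (φ ∨' ψ) = cong₂ _∨'_ (rename-cong e φ) (rename-cong e ψ)
rename-cong e (∀' φ)   = cong ∀' (rename-cong (lift-cong e) φ)
rename-cong e (∃' φ)   = cong ∃' (rename-cong (lift-cong e) φ)

lift-∘ : ∀ {k m n} (ρ : Fin m → Fin n) (σ : Fin k → Fin m) → lift ρ ∘ lift σ ≗ lift (ρ ∘ σ)
lift-∘ ρ σ zero    = refl
lift-∘ ρ σ (suc i) = refl

rename-∘ : ∀ {k m n} (ρ : Fin m → Fin n) (σ : Fin k → Fin m) → rename ρ ∘ rename σ ≗ rename (ρ ∘ σ)
rename-∘ ρ σ (i ∈' j) = refl
rename-∘ ρ σ (i ≐ j)  = refl
rename-∘ ρ σ ⊥'       = refl
rename-∘ ρ σ (φ ⇒ ψ)  = cong₂ _⇒_ (rename-∘ ρ σ φ) (rename-∘ ρ σ ψ)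
rename-∘ ρ σ (φ ∧' ψ) = cong₂ _∧'_ (rename-∘ ρ σ φ) (rename-∘ ρ σ ψ)
rename-∘ ρ σ (φ ∨' ψ) = cong₂ _∨'_ (rename-∘ ρ σ φ) (rename-∘ ρ σ ψ)
rename-∘ ρ σ (∀' φ)   = cong ∀' (trans (rename-∘ (lift ρ) (lift σ) φ) (rename-cong (lift-∘ ρ σ) φ))
rename-∘ ρ σ (∃' φ)   = cong ∃' (trans (rename-∘ (lift ρ) (lift σ) φ) (rename-cong (lift-∘ ρ σ) φ))

lift-id : ∀ {n} {ρ : Fin n → Fin n} → ρ ≗ id' → lift ρ ≗ id'
lift-id e zero    = refl
lift-id e (suc i) = cong suc (e i)

rename-id : ∀ {n} {ρ : Fin n → Fin n} → ρ ≗ id' → rename ρ ≗ id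
rename-id e (i ∈' j) = cong₂ _∈'_ (e i) (e j)
rename-id e (i ≐ j)  = cong₂ _≐_ (e i) (e j)
rename-id e ⊥'       = refl
rename-id e (φ ⇒ ψ)  = cong₂ _⇒_ (rename-id e φ) (rename-id e ψ)
rename-id e (φ ∧' ψ) = cong₂ _∧'_ (rename-id e φ) (rename-id e ψ)
rename-id e (φ ∨' ψ) = cong₂ _∨'_ (rename-id e φ) (rename-id e ψ)
rename-id e (∀' φ)   = cong ∀' (rename-id (lift-id e) φ)
rename-id e (∃' φ)   = cong ∃' (rename-id (lift-id e) φ)

map-map-cong : ∀ {A B B' C : Set} {f : A → B} {g : B → C} {h : A → B'} {k : B' → C} →
               g ∘ f ≗ k ∘ h → map g ∘ map f ≗ map k ∘ map h
map-map-cong e xs = trans (sym (map-∘ xs)) (trans (map-cong e xs) (map-∘ xs))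

wk-rename : ∀ {m n} (ρ : Fin m → Fin n) → wk ∘ rename ρ ≗ rename (lift ρ) ∘ wk
wk-rename ρ φ = trans (rename-∘ suc ρ φ) (sym (rename-∘ (lift ρ) suc φ))

map-wk-rename : ∀ {m n} (ρ : Fin m → Fin n) → map wk ∘ map (rename ρ) ≗ map (rename (lift ρ)) ∘ map wk
map-wk-rename ρ = map-map-cong {f = rename ρ} {g = wk} {h = wk} {k = rename (lift ρ)} (wk-rename ρ)

rename-[] : ∀ {m n} (ρ : Fin m → Fin n) (φ : Fm (suc m)) t →
            rename ρ (φ [ t ]) ≡ rename (lift ρ) φ [ ρ t ]
rename-[] ρ φ t =
  trans (rename-∘ ρ (t ▹ id') φ) (trans (rename-cong pointwise φ) (sym (rename-∘ (ρ t ▹ id') (lift ρ) φ)))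
  where
  pointwise : ρ ∘ (t ▹ id') ≗ (ρ t ▹ id') ∘ lift ρ
  pointwise zero    = refl
  pointwise (suc i) = refl

rename-sentence : ∀ {m n} (ρ : Fin m → Fin n) (σ : Fm 0) → rename ρ (rename fromFin0 σ) ≡ rename fromFin0 σ
rename-sentence ρ σ = trans (rename-∘ ρ fromFin0 σ) (rename-cong (λ ()) σ)

rename-⊢ : ∀ {m n} (ρ : Fin m → Fin n) {Γ : List (Fm m)} {φ} → Γ ⊢ φ → map (rename ρ) Γ ⊢ rename ρ φ
rename-⊢ ρ (hyp p)            = hyp (∈-map⁺ (rename ρ) p)
rename-⊢ ρ (ax {σ = σ} a)     = subst (_ ⊢_) (sym (rename-sentence ρ σ)) (ax a)
rename-⊢ ρ (⇒I d)             = ⇒I (rename-⊢ ρ d)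
rename-⊢ ρ (⇒E d e)           = ⇒E (rename-⊢ ρ d) (rename-⊢ ρ e)
rename-⊢ ρ (∧I d e)           = ∧I (rename-⊢ ρ d) (rename-⊢ ρ e)
rename-⊢ ρ (∧E₁ d)            = ∧E₁ (rename-⊢ ρ d)
rename-⊢ ρ (∧E₂ d)            = ∧E₂ (rename-⊢ ρ d)
rename-⊢ ρ (∨I₁ d)            = ∨I₁ (rename-⊢ ρ d)
rename-⊢ ρ (∨I₂ d)            = ∨I₂ (rename-⊢ ρ d)
rename-⊢ ρ (∨E d e f)         = ∨E (rename-⊢ ρ d) (rename-⊢ ρ e) (rename-⊢ ρ f)
rename-⊢ ρ (⊥E d)             = ⊥E (rename-⊢ ρ d)
rename-⊢ ρ (raa d)            = raa (rename-⊢ ρ d)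
rename-⊢ ρ {Γ} (∀I {φ = φ} d) =
  ∀I (subst (_⊢ rename (lift ρ) φ) (sym (map-wk-rename ρ Γ)) (rename-⊢ (lift ρ) d))
rename-⊢ ρ (∀E {φ = φ} d t)   = subst (_ ⊢_) (sym (rename-[] ρ φ t)) (∀E (rename-⊢ ρ d) (ρ t))
rename-⊢ ρ (∃I {φ = φ} t d)   = ∃I (ρ t) (subst (_ ⊢_) (rename-[] ρ φ t) (rename-⊢ ρ d))
rename-⊢ ρ {Γ} (∃E {φ = φ} {ψ} d e) =
  ∃E (rename-⊢ ρ d)
     (subst₂ (λ Δ χ → rename (lift ρ) φ ∷ Δ ⊢ χ) (sym (map-wk-rename ρ Γ)) (sym (wk-rename ρ ψ))
             (rename-⊢ (lift ρ) e))
rename-⊢ ρ (≐refl t)          = ≐refl (ρ t)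
rename-⊢ ρ (≐subst φ {s} {t} e d) =
  subst (_ ⊢_) (sym (rename-[] ρ φ t))
        (≐subst (rename (lift ρ) φ) (rename-⊢ ρ e) (subst (_ ⊢_) (rename-[] ρ φ s) (rename-⊢ ρ d)))

⊢-mono : ∀ {n} {Γ Δ : List (Fm n)} {φ} → Γ ⊆ Δ → Γ ⊢ φ → Δ ⊢ φ
⊢-mono s (hyp p)        = hyp (s p)
⊢-mono s (ax a)         = ax a
⊢-mono s (⇒I d)         = ⇒I (⊢-mono (∷⁺ʳ _ s) d)
⊢-mono s (⇒E d e)       = ⇒E (⊢-mono s d) (⊢-mono s e)
⊢-mono s (∧I d e)       = ∧I (⊢-mono s d) (⊢-mono s e)
⊢-mono s (∧E₁ d)        = ∧E₁ (⊢-mono s d)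
⊢-mono s (∧E₂ d)        = ∧E₂ (⊢-mono s d)
⊢-mono s (∨I₁ d)        = ∨I₁ (⊢-mono s d)
⊢-mono s (∨I₂ d)        = ∨I₂ (⊢-mono s d)
⊢-mono s (∨E d e f)     = ∨E (⊢-mono s d) (⊢-mono (∷⁺ʳ _ s) e) (⊢-mono (∷⁺ʳ _ s) f)
⊢-mono s (⊥E d)         = ⊥E (⊢-mono s d)
⊢-mono s (raa d)        = raa (⊢-mono (∷⁺ʳ _ s) d)
⊢-mono s (∀I d)         = ∀I (⊢-mono (map⁺ wk s) d)
⊢-mono s (∀E d t)       = ∀E (⊢-mono s d) t
⊢-mono s (∃I t d)       = ∃I t (⊢-mono s d)
⊢-mono s (∃E d e)       = ∃E (⊢-mono s d) (⊢-mono (∷⁺ʳ _ (map⁺ wk s)) e)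
⊢-mono s (≐refl t)      = ≐refl t
⊢-mono s (≐subst φ e d) = ≐subst φ (⊢-mono s e) (⊢-mono s d)

-- Proofs below are written over schemas: formulas whose atoms also include the
-- instances P ⟨ i ⟩ and F ⟨ i , j ⟩ of the formulas P : Fm 1, F : Fm 2 of the
-- given objects and arrows.  Renaming a schema only moves the arguments of these
-- atoms, so the quantifier rules hold on the nose, with no lemma about rename
-- acting inside the (unknown) P and F.

infixr 4 _⇒ˢ_
infixr 5 _∨ˢ_
infixr 6 _∧ˢ_
infix 7 _∈ˢ_ _≐ˢ_ _⟨_⟩ _⟨_,_⟩
infix 3 _⇔ˢ_
infix 2 _⊢ˢ_

data Schema (n : ℕ) : Set where
  _∈ˢ_   : Fin n → Fin n → Schema n
  _≐ˢ_   : Fin n → Fin n → Schema n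
  ⊥ˢ     : Schema n
  _⇒ˢ_   : Schema n → Schema n → Schema n
  _∧ˢ_   : Schema n → Schema n → Schema n
  _∨ˢ_   : Schema n → Schema n → Schema n
  ∀ˢ     : Schema (suc n) → Schema n
  ∃ˢ     : Schema (suc n) → Schema n
  _⟨_⟩   : Fm 1 → Fin n → Schema n
  _⟨_,_⟩ : Fm 2 → Fin n → Fin n → Schema n

¬ˢ : ∀ {n} → Schema n → Schema n
¬ˢ φ = φ ⇒ˢ ⊥ˢ

_⇔ˢ_ : ∀ {n} → Schema n → Schema n → Schema n
φ ⇔ˢ ψ = (φ ⇒ˢ ψ) ∧ˢ (ψ ⇒ˢ φ)

⟨_,_⟩ʳ : ∀ {n} → Fin n → Fin n → Fin 2 → Fin n
⟨ i , j ⟩ʳ = i ▹ (j ▹ fromFin0)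

⟨_,_,_⟩ʳ : ∀ {n} → Fin n → Fin n → Fin n → Fin 3 → Fin n
⟨ i , j , k ⟩ʳ = i ▹ (j ▹ (k ▹ fromFin0))

⟦_⟧ : ∀ {n} → Schema n → Fm n
⟦ i ∈ˢ j ⟧     = i ∈' j
⟦ i ≐ˢ j ⟧     = i ≐ j
⟦ ⊥ˢ ⟧         = ⊥'
⟦ φ ⇒ˢ ψ ⟧     = ⟦ φ ⟧ ⇒ ⟦ ψ ⟧
⟦ φ ∧ˢ ψ ⟧     = ⟦ φ ⟧ ∧' ⟦ ψ ⟧
⟦ φ ∨ˢ ψ ⟧     = ⟦ φ ⟧ ∨' ⟦ ψ ⟧
⟦ ∀ˢ φ ⟧       = ∀' ⟦ φ ⟧
⟦ ∃ˢ φ ⟧       = ∃' ⟦ φ ⟧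
⟦ P ⟨ i ⟩ ⟧     = rename (λ _ → i) P
⟦ F ⟨ i , j ⟩ ⟧ = rename ⟨ i , j ⟩ʳ F

renameˢ : ∀ {m n} → (Fin m → Fin n) → Schema m → Schema n
renameˢ ρ (i ∈ˢ j)     = ρ i ∈ˢ ρ j
renameˢ ρ (i ≐ˢ j)     = ρ i ≐ˢ ρ j
renameˢ ρ ⊥ˢ           = ⊥ˢ
renameˢ ρ (φ ⇒ˢ ψ)     = renameˢ ρ φ ⇒ˢ renameˢ ρ ψ
renameˢ ρ (φ ∧ˢ ψ)     = renameˢ ρ φ ∧ˢ renameˢ ρ ψ
renameˢ ρ (φ ∨ˢ ψ)     = renameˢ ρ φ ∨ˢ renameˢ ρ ψ
renameˢ ρ (∀ˢ φ)       = ∀ˢ (renameˢ (lift ρ) φ)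
renameˢ ρ (∃ˢ φ)       = ∃ˢ (renameˢ (lift ρ) φ)
renameˢ ρ (P ⟨ i ⟩)     = P ⟨ ρ i ⟩
renameˢ ρ (F ⟨ i , j ⟩) = F ⟨ ρ i , ρ j ⟩

⟦renameˢ⟧ : ∀ {m n} (ρ : Fin m → Fin n) → ⟦_⟧ ∘ renameˢ ρ ≗ rename ρ ∘ ⟦_⟧
⟦renameˢ⟧ ρ (i ∈ˢ j)     = refl
⟦renameˢ⟧ ρ (i ≐ˢ j)     = refl
⟦renameˢ⟧ ρ ⊥ˢ           = refl
⟦renameˢ⟧ ρ (φ ⇒ˢ ψ)     = cong₂ _⇒_ (⟦renameˢ⟧ ρ φ) (⟦renameˢ⟧ ρ ψ)
⟦renameˢ⟧ ρ (φ ∧ˢ ψ)     = cong₂ _∧'_ (⟦renameˢ⟧ ρ φ) (⟦renameˢ⟧ ρ ψ)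
⟦renameˢ⟧ ρ (φ ∨ˢ ψ)     = cong₂ _∨'_ (⟦renameˢ⟧ ρ φ) (⟦renameˢ⟧ ρ ψ)
⟦renameˢ⟧ ρ (∀ˢ φ)       = cong ∀' (⟦renameˢ⟧ (lift ρ) φ)
⟦renameˢ⟧ ρ (∃ˢ φ)       = cong ∃' (⟦renameˢ⟧ (lift ρ) φ)
⟦renameˢ⟧ ρ (P ⟨ i ⟩)     = sym (rename-∘ ρ (λ _ → i) P)
⟦renameˢ⟧ ρ (F ⟨ i , j ⟩) = sym (trans (rename-∘ ρ ⟨ i , j ⟩ʳ F) (rename-cong pointwise F))
  where
  pointwise : ρ ∘ ⟨ i , j ⟩ʳ ≗ ⟨ ρ i , ρ j ⟩ʳ
  pointwise zero       = refl
  pointwise (suc zero) = refl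

wkˢ : ∀ {n} → Schema n → Schema (suc n)
wkˢ = renameˢ suc

_[_]ˢ : ∀ {n} → Schema (suc n) → Fin n → Schema n
φ [ t ]ˢ = renameˢ (t ▹ id') φ

record _⊢ˢ_ {n} (Γ : List (Schema n)) (φ : Schema n) : Set where
  constructor mk
  field get : map ⟦_⟧ Γ ⊢ ⟦ φ ⟧
open _⊢ˢ_ public

map-⟦renameˢ⟧ : ∀ {m n} (ρ : Fin m → Fin n) → map ⟦_⟧ ∘ map (renameˢ ρ) ≗ map (rename ρ) ∘ map ⟦_⟧
map-⟦renameˢ⟧ ρ = map-map-cong {f = renameˢ ρ} {g = ⟦_⟧} {h = ⟦_⟧} {k = rename ρ} (⟦renameˢ⟧ ρ)

module _ {n : ℕ} {Γ : List (Schema n)} where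
  hypˢ : ∀ {φ} → φ ∈ Γ → Γ ⊢ˢ φ
  hypˢ p = mk (hyp (∈-map⁺ ⟦_⟧ p))
  ⇒Iˢ : ∀ {φ ψ} → (φ ∷ Γ) ⊢ˢ ψ → Γ ⊢ˢ φ ⇒ˢ ψ
  ⇒Iˢ (mk d) = mk (⇒I d)
  ⇒Eˢ : ∀ {φ ψ} → Γ ⊢ˢ φ ⇒ˢ ψ → Γ ⊢ˢ φ → Γ ⊢ˢ ψ
  ⇒Eˢ (mk d) (mk e) = mk (⇒E d e)
  ∧Iˢ : ∀ {φ ψ} → Γ ⊢ˢ φ → Γ ⊢ˢ ψ → Γ ⊢ˢ φ ∧ˢ ψ
  ∧Iˢ (mk d) (mk e) = mk (∧I d e)
  ∧E₁ˢ : ∀ {φ ψ} → Γ ⊢ˢ φ ∧ˢ ψ → Γ ⊢ˢ φ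
  ∧E₁ˢ (mk d) = mk (∧E₁ d)
  ∧E₂ˢ : ∀ {φ ψ} → Γ ⊢ˢ φ ∧ˢ ψ → Γ ⊢ˢ ψ
  ∧E₂ˢ (mk d) = mk (∧E₂ d)
  ∨I₁ˢ : ∀ {φ ψ} → Γ ⊢ˢ φ → Γ ⊢ˢ φ ∨ˢ ψ
  ∨I₁ˢ (mk d) = mk (∨I₁ d)
  ∨I₂ˢ : ∀ {φ ψ} → Γ ⊢ˢ ψ → Γ ⊢ˢ φ ∨ˢ ψ
  ∨I₂ˢ (mk d) = mk (∨I₂ d)
  ∨Eˢ : ∀ {φ ψ χ} → Γ ⊢ˢ φ ∨ˢ ψ → (φ ∷ Γ) ⊢ˢ χ → (ψ ∷ Γ) ⊢ˢ χ → Γ ⊢ˢ χ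
  ∨Eˢ (mk d) (mk e) (mk f) = mk (∨E d e f)
  ⊥Eˢ : ∀ {φ} → Γ ⊢ˢ ⊥ˢ → Γ ⊢ˢ φ
  ⊥Eˢ (mk d) = mk (⊥E d)
  raaˢ : ∀ {φ} → (¬ˢ φ ∷ Γ) ⊢ˢ ⊥ˢ → Γ ⊢ˢ φ
  raaˢ (mk d) = mk (raa d)
  ∀Iˢ : ∀ {φ} → map wkˢ Γ ⊢ˢ φ → Γ ⊢ˢ ∀ˢ φ
  ∀Iˢ {φ} (mk d) = mk (∀I (subst (_⊢ ⟦ φ ⟧) (map-⟦renameˢ⟧ suc Γ) d))
  ∀Eˢ : ∀ {φ} → Γ ⊢ˢ ∀ˢ φ → (t : Fin n) → Γ ⊢ˢ φ [ t ]ˢ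
  ∀Eˢ {φ} (mk d) t = mk (subst (_ ⊢_) (sym (⟦renameˢ⟧ (t ▹ id') φ)) (∀E d t))
  ∃Iˢ : ∀ {φ} (t : Fin n) → Γ ⊢ˢ φ [ t ]ˢ → Γ ⊢ˢ ∃ˢ φ
  ∃Iˢ {φ} t (mk d) = mk (∃I t (subst (_ ⊢_) (⟦renameˢ⟧ (t ▹ id') φ) d))
  ∃Eˢ : ∀ {φ ψ} → Γ ⊢ˢ ∃ˢ φ → (φ ∷ map wkˢ Γ) ⊢ˢ wkˢ ψ → Γ ⊢ˢ ψ
  ∃Eˢ {φ} {ψ} (mk d) (mk e) =
    mk (∃E d (subst₂ (λ Δ χ → ⟦ φ ⟧ ∷ Δ ⊢ χ) (map-⟦renameˢ⟧ suc Γ) (⟦renameˢ⟧ suc ψ) e))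
  ≐reflˢ : (t : Fin n) → Γ ⊢ˢ t ≐ˢ t
  ≐reflˢ t = mk (≐refl t)
  ≐substˢ : (φ : Schema (suc n)) {s t : Fin n} → Γ ⊢ˢ s ≐ˢ t → Γ ⊢ˢ φ [ s ]ˢ → Γ ⊢ˢ φ [ t ]ˢ
  ≐substˢ φ {s} {t} (mk e) (mk d) =
    mk (subst (_ ⊢_) (sym (⟦renameˢ⟧ (t ▹ id') φ))
              (≐subst ⟦ φ ⟧ e (subst (_ ⊢_) (⟦renameˢ⟧ (s ▹ id') φ) d)))
  castˢ : ∀ {φ ψ} → ⟦ φ ⟧ ≡ ⟦ ψ ⟧ → Γ ⊢ˢ φ → Γ ⊢ˢ ψ
  castˢ e (mk d) = mk (subst (_ ⊢_) e d)

renameˢ-⊢ˢ : ∀ {m n} (ρ : Fin m → Fin n) {Γ : List (Schema m)} {φ} → Γ ⊢ˢ φ → map (renameˢ ρ) Γ ⊢ˢ renameˢ ρ φ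
renameˢ-⊢ˢ ρ {Γ} {φ} (mk d) = mk (subst₂ _⊢_ (sym (map-⟦renameˢ⟧ ρ Γ)) (sym (⟦renameˢ⟧ ρ φ)) (rename-⊢ ρ d))

⊢ˢ-mono : ∀ {n} {Γ Δ : List (Schema n)} {φ} → Γ ⊆ Δ → Γ ⊢ˢ φ → Δ ⊢ˢ φ
⊢ˢ-mono s (mk d) = mk (⊢-mono (map⁺ ⟦_⟧ s) d)

h : ∀ {n} {Γ : List (Schema n)} (k : ℕ) {k<∣Γ∣ : True (suc k ≤? length Γ)} → Γ ⊢ˢ lookup Γ (#_ k {m<n = k<∣Γ∣})
h k {k<∣Γ∣} = hypˢ (∈-lookup (#_ k {m<n = k<∣Γ∣}))

weaken : ∀ {n} {Γ : List (Schema n)} {φ ψ} → Γ ⊢ˢ φ → (ψ ∷ Γ) ⊢ˢ φ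
weaken = ⊢ˢ-mono there

cut : ∀ {n} {Γ : List (Schema n)} {φ ψ} → Γ ⊢ˢ φ → (φ ∷ Γ) ⊢ˢ ψ → Γ ⊢ˢ ψ
cut d e = ⇒Eˢ (⇒Iˢ e) d

apply : ∀ {m n} {φ ψ : Schema m} {Γ : List (Schema n)} →
        (φ ∷ []) ⊢ˢ ψ → (ρ : Fin m → Fin n) → Γ ⊢ˢ renameˢ ρ φ → Γ ⊢ˢ renameˢ ρ ψ
apply L ρ d = ⇒Eˢ (⇒Iˢ (⊢ˢ-mono (λ { (here p) → here p }) (renameˢ-⊢ˢ ρ L))) d

apply₀ : ∀ {m n} {ψ : Schema m} {Γ : List (Schema n)} → [] ⊢ˢ ψ → (ρ : Fin m → Fin n) → Γ ⊢ˢ renameˢ ρ ψ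
apply₀ L ρ = ⊢ˢ-mono (λ ()) (renameˢ-⊢ˢ ρ L)

≐symˢ : ∀ {n} {Γ : List (Schema n)} {s t : Fin n} → Γ ⊢ˢ s ≐ˢ t → Γ ⊢ˢ t ≐ˢ s
≐symˢ {s = s} e = ≐substˢ (zero ≐ˢ suc s) e (≐reflˢ s)

≐transˢ : ∀ {n} {Γ : List (Schema n)} {r s t : Fin n} → Γ ⊢ˢ r ≐ˢ s → Γ ⊢ˢ s ≐ˢ t → Γ ⊢ˢ r ≐ˢ t
≐transˢ {r = r} e f = ≐substˢ (suc r ≐ˢ zero) f e

excluded-middleˢ : ∀ {n} {Γ : List (Schema n)} (φ : Schema n) → Γ ⊢ˢ φ ∨ˢ ¬ˢ φ
excluded-middleˢ φ = raaˢ (⇒Eˢ (h 0) (∨I₂ˢ (⇒Iˢ (⇒Eˢ (h 1) (∨I₁ˢ (h 0))))))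

⇔-reflˢ : ∀ {n} {Γ : List (Schema n)} {φ : Schema n} → Γ ⊢ˢ φ ⇔ˢ φ
⇔-reflˢ = ∧Iˢ (⇒Iˢ (h 0)) (⇒Iˢ (h 0))

unfold₁ : ∀ {n} {Γ : List (Schema n)} (W : Schema 1) {i : Fin n} → Γ ⊢ˢ ⟦ W ⟧ ⟨ i ⟩ → Γ ⊢ˢ renameˢ (λ _ → i) W
unfold₁ W {i} = castˢ (sym (⟦renameˢ⟧ (λ _ → i) W))

fold₁ : ∀ {n} {Γ : List (Schema n)} (W : Schema 1) {i : Fin n} → Γ ⊢ˢ renameˢ (λ _ → i) W → Γ ⊢ˢ ⟦ W ⟧ ⟨ i ⟩
fold₁ W {i} = castˢ (⟦renameˢ⟧ (λ _ → i) W)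

unfold₂ : ∀ {n} {Γ : List (Schema n)} (W : Schema 2) {i j : Fin n} →
          Γ ⊢ˢ ⟦ W ⟧ ⟨ i , j ⟩ → Γ ⊢ˢ renameˢ ⟨ i , j ⟩ʳ W
unfold₂ W {i} {j} = castˢ (sym (⟦renameˢ⟧ ⟨ i , j ⟩ʳ W))

fold₂ : ∀ {n} {Γ : List (Schema n)} (W : Schema 2) {i j : Fin n} →
        Γ ⊢ˢ renameˢ ⟨ i , j ⟩ʳ W → Γ ⊢ˢ ⟦ W ⟧ ⟨ i , j ⟩
fold₂ W {i} {j} = castˢ (⟦renameˢ⟧ ⟨ i , j ⟩ʳ W)

rename-⟨0⟩ : (P : Fm 1) → rename (λ _ → # 0) P ≡ P
rename-⟨0⟩ = rename-id (λ { zero → refl })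

rename-⟨0,1⟩ : (F : Fm 2) → rename ⟨ # 0 , # 1 ⟩ʳ F ≡ F
rename-⟨0,1⟩ = rename-id (λ { zero → refl ; (suc zero) → refl })

-- Arrows of DCL[ZF]

module _ {X Y : Obj} (a : Hom X Y) where
  typedˢ : (F a ⟨ # 0 , # 1 ⟩ ∷ []) ⊢ˢ X ⟨ # 0 ⟩ ∧ˢ Y ⟨ # 1 ⟩
  typedˢ = mk (subst (λ φ → φ ∷ [] ⊢ _) (sym (rename-⟨0,1⟩ (F a))) (typed a))

  functionalˢ : (F a ⟨ # 0 , # 1 ⟩ ∧ˢ F a ⟨ # 0 , # 2 ⟩ ∷ []) ⊢ˢ # 1 ≐ˢ # 2
  functionalˢ = mk (functional a)

  totalˢ : (X ⟨ # 0 ⟩ ∷ []) ⊢ˢ ∃ˢ (F a ⟨ # 1 , # 0 ⟩)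
  totalˢ = mk (subst (λ φ → φ ∷ [] ⊢ _) (sym (rename-⟨0⟩ X)) (total a))

compˢ : Fm 2 → Fm 2 → Schema 2
compˢ G H = ∃ˢ (G ⟨ # 1 , # 0 ⟩ ∧ˢ H ⟨ # 0 , # 2 ⟩)

total-from : ∀ {X} (W : Fm 2) → (X ⟨ # 0 ⟩ ∷ []) ⊢ˢ ∃ˢ (W ⟨ # 1 , # 0 ⟩) →
             X ∷ [] ⊢ ∃' (rename ⟨ # 1 , # 0 ⟩ʳ W)
total-from {X} W d = subst (λ φ → φ ∷ [] ⊢ _) (rename-⟨0⟩ X) (get d)

infixr 9 _∘ₕ_
_∘ₕ_ : {X Y Z : Obj} → Hom Y Z → Hom X Y → Hom X Z
_∘ₕ_ {X} {Y} {Z} b a = record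
  { F = compF (F a) (F b) ; typed = get ty ; functional = get fu ; total = total-from (compF (F a) (F b)) tot }
  where
  ty : (compˢ (F a) (F b) ∷ []) ⊢ˢ X ⟨ # 0 ⟩ ∧ˢ Z ⟨ # 1 ⟩
  ty = ∃Eˢ (h 0) (∧Iˢ (∧E₁ˢ (apply (typedˢ a) ⟨ # 1 , # 0 ⟩ʳ (∧E₁ˢ (h 0))))
                   (∧E₂ˢ (apply (typedˢ b) ⟨ # 0 , # 2 ⟩ʳ (∧E₂ˢ (h 0)))))
  W : Fm 2
  W = compF (F a) (F b)
  fu : (W ⟨ # 0 , # 1 ⟩ ∧ˢ W ⟨ # 0 , # 2 ⟩ ∷ []) ⊢ˢ # 1 ≐ˢ # 2
  fu = ∃Eˢ (unfold₂ (compˢ (F a) (F b)) (∧E₁ˢ (h 0)))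
         (∃Eˢ (unfold₂ (compˢ (F a) (F b)) (∧E₂ˢ (h 1)))
           (cut (apply (functionalˢ a) ⟨ # 2 , # 1 , # 0 ⟩ʳ (∧Iˢ (∧E₁ˢ (h 1)) (∧E₁ˢ (h 0))))
             (apply (functionalˢ b) ⟨ # 1 , # 3 , # 4 ⟩ʳ
               (∧Iˢ (∧E₂ˢ (h 2)) (≐substˢ (F b ⟨ # 0 , # 5 ⟩) (≐symˢ (h 0)) (∧E₂ˢ (h 1)))))))
  tot : (X ⟨ # 0 ⟩ ∷ []) ⊢ˢ ∃ˢ (W ⟨ # 1 , # 0 ⟩)
  tot = ∃Eˢ (apply (totalˢ a) (λ _ → # 0) (h 0))
          (∃Eˢ (apply (totalˢ b) (λ _ → # 0) (∧E₂ˢ (apply (typedˢ a) ⟨ # 1 , # 0 ⟩ʳ (h 0))))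
            (∃Iˢ (# 0) (fold₂ (compˢ (F a) (F b)) (∃Iˢ (# 1) (∧Iˢ (h 1) (h 0))))))

≈F-sym : ∀ {G H} → G ≈F H → H ≈F G
≈F-sym d = ∧I (∧E₂ d) (∧E₁ d)

≈F-trans : ∀ {G H K} → G ≈F H → H ≈F K → G ≈F K
≈F-trans d e = ∧I (⇒I (⇒E (⊢-mono there (∧E₁ e)) (⇒E (⊢-mono there (∧E₁ d)) (hyp (here refl)))))
                  (⇒I (⇒E (⊢-mono there (∧E₂ d)) (⇒E (⊢-mono there (∧E₂ e)) (hyp (here refl)))))

compF-precompose : ∀ {V M N M' N' : Fm 2} → (compˢ M N ∷ []) ⊢ˢ compˢ M' N' →
                   (compˢ (compF V M) N ∷ []) ⊢ˢ compˢ (compF V M') N'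
compF-precompose {V} {M} {N} {M'} {N'} M∘N⊢M'∘N' =
  ∃Eˢ (h 0) (∃Eˢ (unfold₂ (compˢ V M) (∧E₁ˢ (h 0)))
    (cut (apply M∘N⊢M'∘N' ⟨ # 0 , # 3 ⟩ʳ (∃Iˢ (# 1) (∧Iˢ (∧E₂ˢ (h 0)) (∧E₂ˢ (h 1)))))
      (∃Eˢ (h 0) (∃Iˢ (# 0) (∧Iˢ (fold₂ (compˢ V M') (∃Iˢ (# 1) (∧Iˢ (∧E₁ˢ (h 2)) (∧E₁ˢ (h 0)))))
                                 (∧E₂ˢ (h 0)))))))

compF-precompose-≈ : ∀ {V M N M' N' : Fm 2} → compF M N ≈F compF M' N' →
                     compF (compF V M) N ≈F compF (compF V M') N'
compF-precompose-≈ {V} {M} {N} {M'} {N'} d =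
  get (∧Iˢ (⇒Iˢ (compF-precompose {V} (⇒Eˢ (weaken (∧E₁ˢ M∘N⇔M'∘N')) (h 0))))
           (⇒Iˢ (compF-precompose {V} (⇒Eˢ (weaken (∧E₂ˢ M∘N⇔M'∘N')) (h 0)))))
  where
  M∘N⇔M'∘N' : [] ⊢ˢ compˢ M N ⇔ˢ compˢ M' N'
  M∘N⇔M'∘N' = mk d

-- Set theory

ReplacementSchema : Schema 3 → Schema 0
ReplacementSchema φ =
  ∀ˢ ( ∀ˢ (∀ˢ (∀ˢ ( renameˢ ((# 2) ▹ ((# 1) ▹ (3 ↑ʳ_))) φ
                   ∧ˢ renameˢ ((# 2) ▹ ((# 0) ▹ (3 ↑ʳ_))) φ
                   ⇒ˢ # 1 ≐ˢ # 0)))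
     ⇒ˢ ∀ˢ (∃ˢ (∀ˢ ((# 0 ∈ˢ # 1) ⇔ˢ ∃ˢ (# 0 ∈ˢ # 3 ∧ˢ renameˢ ((# 0) ▹ ((# 1) ▹ (4 ↑ʳ_))) φ)))))

replacementˢ : ∀ {n} {Γ : List (Schema n)} (φ : Schema 3) → Γ ⊢ˢ renameˢ fromFin0 (ReplacementSchema φ)
replacementˢ {Γ = Γ} φ =
  mk (subst (map ⟦_⟧ Γ ⊢_)
            (trans (cong (rename fromFin0) (sym ⟦ReplacementSchema⟧)) (sym (⟦renameˢ⟧ fromFin0 (ReplacementSchema φ))))
            (ax (ax-rep 1 ⟦ φ ⟧)))
  where
  ⟦ReplacementSchema⟧ : ⟦ ReplacementSchema φ ⟧ ≡ Replacement 1 ⟦ φ ⟧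
  ⟦ReplacementSchema⟧ rewrite ⟦renameˢ⟧ ((# 2) ▹ ((# 1) ▹ (3 ↑ʳ_))) φ
                            | ⟦renameˢ⟧ ((# 2) ▹ ((# 0) ▹ (3 ↑ʳ_))) φ
                            | ⟦renameˢ⟧ ((# 0) ▹ ((# 1) ▹ (4 ↑ʳ_))) φ = refl

IsPair : ∀ {n} → Fin n → Fin n → Fin n → Schema n
IsPair w a b = ∀ˢ ((# 0 ∈ˢ suc w) ⇔ˢ (# 0 ≐ˢ suc a ∨ˢ # 0 ≐ˢ suc b))

pair-exists : ∀ {n} {Γ : List (Schema n)} (a b : Fin n) → Γ ⊢ˢ ∃ˢ (IsPair (# 0) (suc a) (suc b))
pair-exists a b =
  ∃Eˢ (∀Eˢ (∀Eˢ pairing a) b)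
    (∃Eˢ (∀Eˢ (∀Eˢ (∀Eˢ separation (suc a)) (suc b)) (# 0))
      (∃Iˢ (# 0) (∀Iˢ
        (∧Iˢ (⇒Iˢ (∧E₂ˢ (⇒Eˢ (∧E₁ˢ (∀Eˢ (h 1) (# 0))) (h 0))))
             (⇒Iˢ (⇒Eˢ (∧E₂ˢ (∀Eˢ (h 1) (# 0)))
                 (∧Iˢ (∨Eˢ (h 0) (≐substˢ (# 0 ∈ˢ # 3) (≐symˢ (h 0)) (∧E₁ˢ (h 3)))
                              (≐substˢ (# 0 ∈ˢ # 3) (≐symˢ (h 0)) (∧E₂ˢ (h 3))))
                      (h 0))))))))
  where
  pairing : ∀ {n} {Γ : List (Schema n)} → Γ ⊢ˢ ∀ˢ (∀ˢ (∃ˢ (# 2 ∈ˢ # 0 ∧ˢ # 1 ∈ˢ # 0)))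
  pairing = mk (ax ax-pair)
  separation : ∀ {n} {Γ : List (Schema n)} →
               Γ ⊢ˢ ∀ˢ (∀ˢ (∀ˢ (∃ˢ (∀ˢ ((# 0 ∈ˢ # 1) ⇔ˢ (# 0 ∈ˢ # 2 ∧ˢ (# 0 ≐ˢ # 4 ∨ˢ # 0 ≐ˢ # 3)))))))
  separation = mk (ax (ax-sep 2 (# 0 ≐ # 2 ∨' # 0 ≐ # 1)))

-- For e = {{a}, {a, b}}, a is the only set lying in every member of e, and b the only
-- set lying in some member of e such that, if it lies in every member, it is the only
-- element of the members (which covers a = b).
InEvery : ∀ {n} → Fin n → Fin n → Schema n
InEvery e d = ∀ˢ (# 0 ∈ˢ suc e ⇒ˢ suc d ∈ˢ # 0)

SndCandidate : ∀ {n} → Fin n → Fin n → Schema n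
SndCandidate e d = ∃ˢ (# 0 ∈ˢ suc e ∧ˢ suc d ∈ˢ # 0)
                   ∧ˢ (InEvery e d ⇒ˢ ∀ˢ (# 0 ∈ˢ suc e ⇒ˢ ∀ˢ (# 0 ∈ˢ # 1 ⇒ˢ # 0 ≐ˢ suc (suc d))))

IsFst : ∀ {n} → Fin n → Fin n → Schema n
IsFst e d = InEvery e d ∧ˢ ∀ˢ (InEvery (suc e) (# 0) ⇒ˢ # 0 ≐ˢ suc d)

IsSnd : ∀ {n} → Fin n → Fin n → Schema n
IsSnd e d = SndCandidate e d ∧ˢ ∀ˢ (SndCandidate (suc e) (# 0) ⇒ˢ # 0 ≐ˢ suc d)

-- Variables: e = # 0, s' = # 1, s = # 2, b = # 3, a = # 4.
KuratowskiPair : List (Schema 5)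
KuratowskiPair = IsPair (# 0) (# 2) (# 1) ∷ IsPair (# 1) (# 4) (# 3) ∷ IsPair (# 2) (# 4) (# 4) ∷ []

ElementsOfMembersAreAOrB : Schema 5
ElementsOfMembersAreAOrB = ∀ˢ (∀ˢ (# 1 ∈ˢ # 2 ⇒ˢ # 0 ∈ˢ # 1 ⇒ˢ (# 0 ≐ˢ # 6 ∨ˢ # 0 ≐ˢ # 5)))

elements-of-members : KuratowskiPair ⊢ˢ ElementsOfMembersAreAOrB
elements-of-members = ∀Iˢ (∀Iˢ (⇒Iˢ (⇒Iˢ
  (∨Eˢ (⇒Eˢ (∧E₁ˢ (∀Eˢ (h 2) (# 1))) (h 1))
     (∨Eˢ (⇒Eˢ (∧E₁ˢ (∀Eˢ (h 5) (# 0))) (≐substˢ (# 1 ∈ˢ # 0) (h 0) (h 1))) (∨I₁ˢ (h 0)) (∨I₁ˢ (h 0)))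
     (⇒Eˢ (∧E₁ˢ (∀Eˢ (h 4) (# 0))) (≐substˢ (# 1 ∈ˢ # 0) (h 0) (h 1)))))))

kuratowski-projections : KuratowskiPair ⊢ˢ IsFst (# 0) (# 4) ∧ˢ IsSnd (# 0) (# 3)
kuratowski-projections =
  cut (⇒Eˢ (∧E₂ˢ (∀Eˢ (h 2) (# 4))) (∨I₁ˢ (≐reflˢ (# 4))))
  (cut (⇒Eˢ (∧E₂ˢ (∀Eˢ (h 2) (# 4))) (∨I₁ˢ (≐reflˢ (# 4))))
  (cut (⇒Eˢ (∧E₂ˢ (∀Eˢ (h 3) (# 3))) (∨I₂ˢ (≐reflˢ (# 3))))
  (cut (⇒Eˢ (∧E₂ˢ (∀Eˢ (h 3) (# 2))) (∨I₁ˢ (≐reflˢ (# 2))))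
  (cut (⇒Eˢ (∧E₂ˢ (∀Eˢ (h 4) (# 1))) (∨I₂ˢ (≐reflˢ (# 1))))
  (cut (⊢ˢ-mono (xs⊆ys++xs KuratowskiPair (_ ∷ _ ∷ _ ∷ _ ∷ _ ∷ [])) elements-of-members)
  (cut a-in-every
    (∧Iˢ (∧Iˢ (h 0) a-unique) (∧Iˢ (∧Iˢ (∃Iˢ (# 1) (∧Iˢ (h 2) (h 4))) b-candidate) b-unique))))))))
  where
  Γ : List (Schema 5)
  Γ = ElementsOfMembersAreAOrB ∷ # 1 ∈ˢ # 0 ∷ # 2 ∈ˢ # 0 ∷ # 3 ∈ˢ # 1 ∷ # 4 ∈ˢ # 1 ∷ # 4 ∈ˢ # 2 ∷ KuratowskiPair
  a-in-every : Γ ⊢ˢ InEvery (# 0) (# 4)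
  a-in-every = ∀Iˢ (⇒Iˢ (∨Eˢ (⇒Eˢ (∧E₁ˢ (∀Eˢ (h 7) (# 0))) (h 0))
                          (≐substˢ (# 6 ∈ˢ # 0) (≐symˢ (h 0)) (h 7))
                          (≐substˢ (# 6 ∈ˢ # 0) (≐symˢ (h 0)) (h 6))))
  a-unique : (InEvery (# 0) (# 4) ∷ Γ) ⊢ˢ ∀ˢ (InEvery (# 1) (# 0) ⇒ˢ # 0 ≐ˢ # 5)
  a-unique = ∀Iˢ (⇒Iˢ (∨Eˢ (⇒Eˢ (∧E₁ˢ (∀Eˢ (h 10) (# 0))) (⇒Eˢ (∀Eˢ (h 0) (# 3)) (h 4))) (h 0) (h 0)))
  b-candidate : (InEvery (# 0) (# 4) ∷ Γ) ⊢ˢ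
                InEvery (# 0) (# 3) ⇒ˢ ∀ˢ (# 0 ∈ˢ # 1 ⇒ˢ ∀ˢ (# 0 ∈ˢ # 1 ⇒ˢ # 0 ≐ˢ # 5))
  b-candidate = ⇒Iˢ (cut (∨Eˢ (⇒Eˢ (∧E₁ˢ (∀Eˢ (h 10) (# 3))) (⇒Eˢ (∀Eˢ (h 0) (# 2)) (h 4))) (h 0) (h 0))
            (∀Iˢ (⇒Iˢ (∀Iˢ (⇒Iˢ
              (∨Eˢ (⇒Eˢ (⇒Eˢ (∀Eˢ (∀Eˢ (h 5) (# 1)) (# 0)) (h 1)) (h 0))
                 (≐transˢ (h 0) (≐symˢ (h 3)))
                 (h 0)))))))
  b-unique : (InEvery (# 0) (# 4) ∷ Γ) ⊢ˢ ∀ˢ (SndCandidate (# 1) (# 0) ⇒ˢ # 0 ≐ˢ # 4)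
  b-unique = ∀Iˢ (⇒Iˢ (∃Eˢ (∧E₁ˢ (h 0))
            (∨Eˢ (⇒Eˢ (⇒Eˢ (∀Eˢ (∀Eˢ (h 3) (# 0)) (# 1)) (∧E₁ˢ (h 0))) (∧E₂ˢ (h 0)))
              (≐symˢ (⇒Eˢ (∀Eˢ (⇒Eˢ (∀Eˢ (⇒Eˢ (∧E₂ˢ (h 2))
                                                (≐substˢ (∀ˢ (# 0 ∈ˢ # 4 ⇒ˢ # 1 ∈ˢ # 0)) (≐symˢ (h 0)) (h 3)))
                                          (# 3)) (h 5)) (# 5)) (h 7)))
              (h 0))))

kuratowski-pair-exists : ∀ {n} {Γ : List (Schema n)} (x₁ x₂ : Fin n) →
                         Γ ⊢ˢ ∃ˢ (IsFst (# 0) (suc x₁) ∧ˢ IsSnd (# 0) (suc x₂))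
kuratowski-pair-exists {n} x₁ x₂ =
  ∃Eˢ (pair-exists x₁ x₁)
   (∃Eˢ (pair-exists (suc x₁) (suc x₂))
    (∃Eˢ (pair-exists (# 1) (# 0))
     (∃Iˢ (# 0) (⇒Eˢ (⇒Eˢ (⇒Eˢ (apply₀ projections ρ) (h 2)) (h 1)) (h 0)))))
  where
  projections : [] ⊢ˢ IsPair (# 2) (# 4) (# 4) ⇒ˢ IsPair (# 1) (# 4) (# 3) ⇒ˢ IsPair (# 0) (# 2) (# 1)
                      ⇒ˢ IsFst (# 0) (# 4) ∧ˢ IsSnd (# 0) (# 3)
  projections = ⇒Iˢ (⇒Iˢ (⇒Iˢ kuratowski-projections))
  ρ : Fin 5 → Fin (3 + n)
  ρ = (# 0) ▹ ((# 1) ▹ ((# 2) ▹ (suc (suc (suc x₂)) ▹ (suc (suc (suc x₁)) ▹ fromFin0))))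


-- Pullbacks

module KernelPair {D A B : Obj} (p : Hom D A) (q : Hom D B) where

  SameImages : ∀ {n} → Fin n → Fin n → Schema n
  SameImages x₁ x₂ = ∃ˢ (∃ˢ (F q ⟨ suc (suc x₁) , # 1 ⟩ ∧ˢ F q ⟨ suc (suc x₂) , # 1 ⟩
                            ∧ˢ F p ⟨ suc (suc x₁) , # 0 ⟩ ∧ˢ F p ⟨ suc (suc x₂) , # 0 ⟩))

  IsKernelPairElement : ∀ {n} → Fin n → Schema n
  IsKernelPairElement e =
    ∃ˢ (∃ˢ (IsFst (suc (suc e)) (# 1) ∧ˢ IsSnd (suc (suc e)) (# 0) ∧ˢ SameImages (# 1) (# 0)))

  K : Obj
  K = ⟦ IsKernelPairElement (# 0) ⟧

  Proj₁ Proj₂ : ∀ {n} → Fin n → Fin n → Schema n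
  Proj₁ e d = IsKernelPairElement e ∧ˢ IsFst e d
  Proj₂ e d = IsKernelPairElement e ∧ˢ IsSnd e d

  fst-in-D : (SameImages {2} (# 1) (# 0) ∷ []) ⊢ˢ D ⟨ # 1 ⟩
  fst-in-D = ∃Eˢ (h 0) (∃Eˢ (h 0) (∧E₁ˢ (apply (typedˢ q) ⟨ # 3 , # 1 ⟩ʳ (∧E₁ˢ (h 0)))))

  snd-in-D : (SameImages {2} (# 1) (# 0) ∷ []) ⊢ˢ D ⟨ # 0 ⟩
  snd-in-D = ∃Eˢ (h 0) (∃Eˢ (h 0) (∧E₁ˢ (apply (typedˢ q) ⟨ # 2 , # 1 ⟩ʳ (∧E₁ˢ (∧E₂ˢ (h 0))))))

  π₁ : Hom K D
  π₁ = record { F = ⟦ Proj₁ (# 0) (# 1) ⟧ ; typed = get ty ; functional = get fu ; total = total-from _ tot }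
    where
    ty : (Proj₁ (# 0) (# 1) ∷ []) ⊢ˢ K ⟨ # 0 ⟩ ∧ˢ D ⟨ # 1 ⟩
    ty = ∧Iˢ (fold₁ (IsKernelPairElement (# 0)) (∧E₁ˢ (h 0)))
             (∃Eˢ (∧E₁ˢ (h 0)) (∃Eˢ (h 0)
               (≐substˢ (D ⟨ # 0 ⟩)
                  (⇒Eˢ (∀Eˢ (∧E₂ˢ (∧E₂ˢ (h 2))) (# 1)) (∧E₁ˢ (∧E₁ˢ (h 0))))
                  (apply fst-in-D ⟨ # 0 , # 1 ⟩ʳ (∧E₂ˢ (∧E₂ˢ (h 0)))))))
    fu : (⟦ Proj₁ (# 0) (# 1) ⟧ ⟨ # 0 , # 1 ⟩ ∧ˢ ⟦ Proj₁ (# 0) (# 1) ⟧ ⟨ # 0 , # 2 ⟩ ∷ []) ⊢ˢ # 1 ≐ˢ # 2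
    fu = ⇒Eˢ (∀Eˢ (∧E₂ˢ (∧E₂ˢ (unfold₂ (Proj₁ (# 0) (# 1)) (∧E₂ˢ (h 0))))) (# 1))
             (∧E₁ˢ (∧E₂ˢ (unfold₂ (Proj₁ (# 0) (# 1)) (∧E₁ˢ (h 0)))))
    tot : (K ⟨ # 0 ⟩ ∷ []) ⊢ˢ ∃ˢ (⟦ Proj₁ (# 0) (# 1) ⟧ ⟨ # 1 , # 0 ⟩)
    tot = cut (unfold₁ (IsKernelPairElement (# 0)) (h 0))
            (∃Eˢ (h 0) (∃Eˢ (h 0) (∃Iˢ (# 1) (fold₂ (Proj₁ (# 0) (# 1)) (∧Iˢ (h 2) (∧E₁ˢ (h 0)))))))

  π₂ : Hom K D
  π₂ = record { F = ⟦ Proj₂ (# 0) (# 1) ⟧ ; typed = get ty ; functional = get fu ; total = total-from _ tot }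
    where
    ty : (Proj₂ (# 0) (# 1) ∷ []) ⊢ˢ K ⟨ # 0 ⟩ ∧ˢ D ⟨ # 1 ⟩
    ty = ∧Iˢ (fold₁ (IsKernelPairElement (# 0)) (∧E₁ˢ (h 0)))
             (∃Eˢ (∧E₁ˢ (h 0)) (∃Eˢ (h 0)
               (≐substˢ (D ⟨ # 0 ⟩)
                  (⇒Eˢ (∀Eˢ (∧E₂ˢ (∧E₂ˢ (h 2))) (# 0)) (∧E₁ˢ (∧E₁ˢ (∧E₂ˢ (h 0)))))
                  (apply snd-in-D ⟨ # 0 , # 1 ⟩ʳ (∧E₂ˢ (∧E₂ˢ (h 0)))))))
    fu : (⟦ Proj₂ (# 0) (# 1) ⟧ ⟨ # 0 , # 1 ⟩ ∧ˢ ⟦ Proj₂ (# 0) (# 1) ⟧ ⟨ # 0 , # 2 ⟩ ∷ []) ⊢ˢ # 1 ≐ˢ # 2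
    fu = ⇒Eˢ (∀Eˢ (∧E₂ˢ (∧E₂ˢ (unfold₂ (Proj₂ (# 0) (# 1)) (∧E₂ˢ (h 0))))) (# 1))
             (∧E₁ˢ (∧E₂ˢ (unfold₂ (Proj₂ (# 0) (# 1)) (∧E₁ˢ (h 0)))))
    tot : (K ⟨ # 0 ⟩ ∷ []) ⊢ˢ ∃ˢ (⟦ Proj₂ (# 0) (# 1) ⟧ ⟨ # 1 , # 0 ⟩)
    tot = cut (unfold₁ (IsKernelPairElement (# 0)) (h 0))
            (∃Eˢ (h 0) (∃Eˢ (h 0) (∃Iˢ (# 0) (fold₂ (Proj₂ (# 0) (# 1)) (∧Iˢ (h 2) (∧E₁ˢ (∧E₂ˢ (h 0))))))))

  ∘π₂≈∘π₁ : ∀ {X} (a : Hom D X) →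
            (SameImages {2} (# 1) (# 0) ∷ []) ⊢ˢ ∃ˢ (F a ⟨ # 2 , # 0 ⟩ ∧ˢ F a ⟨ # 1 , # 0 ⟩) →
            (a ∘F π₂) ≈F (a ∘F π₁)
  ∘π₂≈∘π₁ a same-a-image = get (∧Iˢ (⇒Iˢ from₂) (⇒Iˢ from₁))
    where
    W : Fm 2
    W = F a
    from₂ : (compˢ (F π₂) W ∷ []) ⊢ˢ compˢ (F π₁) W
    from₂ =
      ∃Eˢ (h 0) (cut (unfold₂ (Proj₂ (# 0) (# 1)) (∧E₁ˢ (h 0)))
        (∃Eˢ (∧E₁ˢ (h 0)) (∃Eˢ (h 0)
          (cut (⇒Eˢ (∀Eˢ (∧E₂ˢ (∧E₂ˢ (h 2))) (# 0)) (∧E₁ˢ (∧E₁ˢ (∧E₂ˢ (h 0)))))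
          (cut (apply same-a-image ⟨ # 0 , # 1 ⟩ʳ (∧E₂ˢ (∧E₂ˢ (h 1))))
          (∃Eˢ (h 0)
            (∃Iˢ (# 2) (∧Iˢ (fold₂ (Proj₁ (# 0) (# 1)) (∧Iˢ (∧E₁ˢ (h 5)) (∧E₁ˢ (h 3))))
               (≐substˢ (W ⟨ # 3 , # 0 ⟩)
                  (apply (functionalˢ a) ⟨ # 1 , # 0 , # 5 ⟩ʳ
                    (∧Iˢ (∧E₂ˢ (h 0)) (≐substˢ (W ⟨ # 0 , # 6 ⟩) (≐symˢ (h 2)) (∧E₂ˢ (h 6)))))
                  (∧E₁ˢ (h 0)))))))))))
    from₁ : (compˢ (F π₁) W ∷ []) ⊢ˢ compˢ (F π₂) W
    from₁ =
      ∃Eˢ (h 0) (cut (unfold₂ (Proj₁ (# 0) (# 1)) (∧E₁ˢ (h 0)))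
        (∃Eˢ (∧E₁ˢ (h 0)) (∃Eˢ (h 0)
          (cut (⇒Eˢ (∀Eˢ (∧E₂ˢ (∧E₂ˢ (h 2))) (# 1)) (∧E₁ˢ (∧E₁ˢ (h 0))))
          (cut (apply same-a-image ⟨ # 0 , # 1 ⟩ʳ (∧E₂ˢ (∧E₂ˢ (h 1))))
          (∃Eˢ (h 0)
            (∃Iˢ (# 1) (∧Iˢ (fold₂ (Proj₂ (# 0) (# 1)) (∧Iˢ (∧E₁ˢ (h 5)) (∧E₁ˢ (∧E₂ˢ (h 3)))))
               (≐substˢ (W ⟨ # 2 , # 0 ⟩)
                  (apply (functionalˢ a) ⟨ # 2 , # 0 , # 5 ⟩ʳ
                    (∧Iˢ (∧E₁ˢ (h 0)) (≐substˢ (W ⟨ # 0 , # 6 ⟩) (≐symˢ (h 2)) (∧E₂ˢ (h 6)))))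
                  (∧E₂ˢ (h 0)))))))))))

  same-p-image : (SameImages {2} (# 1) (# 0) ∷ []) ⊢ˢ ∃ˢ (F p ⟨ # 2 , # 0 ⟩ ∧ˢ F p ⟨ # 1 , # 0 ⟩)
  same-p-image = ∃Eˢ (h 0) (∃Eˢ (h 0) (∃Iˢ (# 0) (∧Iˢ (∧E₁ˢ (∧E₂ˢ (∧E₂ˢ (h 0)))) (∧E₂ˢ (∧E₂ˢ (∧E₂ˢ (h 0)))))))

  same-q-image : (SameImages {2} (# 1) (# 0) ∷ []) ⊢ˢ ∃ˢ (F q ⟨ # 2 , # 0 ⟩ ∧ˢ F q ⟨ # 1 , # 0 ⟩)
  same-q-image = ∃Eˢ (h 0) (∃Eˢ (h 0) (∃Iˢ (# 1) (∧Iˢ (∧E₁ˢ (h 0)) (∧E₁ˢ (∧E₂ˢ (h 0))))))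

  -- For x₁, x₂ with the same images, ⟨x₁, x₂⟩ has first projection x₁, hence (as π₁ = π₂)
  -- second projection x₁; but its second projection is x₂.
  π₁≈π₂⇒jointly-monic : π₁ ≈ π₂ → (SameImages {2} (# 1) (# 0) ∷ []) ⊢ˢ # 1 ≐ˢ # 0
  π₁≈π₂⇒jointly-monic π₁≈π₂ =
    ∃Eˢ (kuratowski-pair-exists (# 1) (# 0))
      (cut (unfold₂ (Proj₂ (# 0) (# 1))
             (⇒Eˢ (∧E₁ˢ (apply₀ Proj₁⇔Proj₂ ⟨ # 0 , # 2 ⟩ʳ))
                  (fold₂ (Proj₁ (# 0) (# 1))
                    (∧Iˢ (∃Iˢ (# 2) (∃Iˢ (# 1) (∧Iˢ (∧E₁ˢ (h 0)) (∧Iˢ (∧E₂ˢ (h 0)) (h 1))))) (∧E₁ˢ (h 0))))))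
        (⇒Eˢ (∀Eˢ (∧E₂ˢ (∧E₂ˢ (h 1))) (# 2)) (∧E₁ˢ (∧E₂ˢ (h 0)))))
    where
    Proj₁⇔Proj₂ : [] ⊢ˢ ⟦ Proj₁ (# 0) (# 1) ⟧ ⟨ # 0 , # 1 ⟩ ⇔ˢ ⟦ Proj₂ (# 0) (# 1) ⟧ ⟨ # 0 , # 1 ⟩
    Proj₁⇔Proj₂ = mk (subst₂ (λ G H → [] ⊢ G ⇔ H) (sym (rename-⟨0,1⟩ (F π₁))) (sym (rename-⟨0,1⟩ (F π₂))) π₁≈π₂)

module _ {A B C D : Obj} {f : Hom A C} {g : Hom B C} {p : Hom D A} {f' : Hom D B} where
  open KernelPair p f'

  pullback-jointly-monic : IsPullback f g p f' → (SameImages {2} (# 1) (# 0) ∷ []) ⊢ˢ # 1 ≐ˢ # 0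
  pullback-jointly-monic pb = π₁≈π₂⇒jointly-monic (≈F-trans π₁≈u (≈F-sym π₂≈u))
    where
    p∘π₁ : Hom K A
    p∘π₁ = p ∘ₕ π₁
    f'∘π₁ : Hom K B
    f'∘π₁ = f' ∘ₕ π₁
    open Σ (IsPullback.universal pb K p∘π₁ f'∘π₁ (compF-precompose-≈ {F π₁} (IsPullback.commutes pb)))
      renaming (proj₁ to u; proj₂ to u-universal)
    unique : (v : Hom K D) → (p ∘F v) ≈F F p∘π₁ → (f' ∘F v) ≈F F f'∘π₁ → v ≈ u
    unique = proj₂ (proj₂ u-universal)
    π₁≈u : π₁ ≈ u
    π₁≈u = unique π₁ (get (⇔-reflˢ {φ = compˢ (F π₁) (F p)})) (get (⇔-reflˢ {φ = compˢ (F π₁) (F f')}))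
    π₂≈u : π₂ ≈ u
    π₂≈u = unique π₂ (∘π₂≈∘π₁ p same-p-image) (∘π₂≈∘π₁ f' same-q-image)

  small-if-jointly-monic : (f ∘F p) ≈F (g ∘F f') → (SameImages {2} (# 1) (# 0) ∷ []) ⊢ˢ # 1 ≐ˢ # 0 →
                           Small f → Small f'
  small-if-jointly-monic commutes jointly-monic small-f = get fibres-are-sets
    where
    P Q : Fm 2
    P = F p
    Q = F f'
    FibreIsSet : Schema 1
    FibreIsSet = ∃ˢ (∀ˢ (Q ⟨ # 0 , # 2 ⟩ ⇔ˢ # 0 ∈ˢ # 1))
    fibres-are-sets : _⊢ˢ_ {0} [] (∀ˢ FibreIsSet)
    fibres-are-sets = ∀Iˢ (∨Eˢ (excluded-middleˢ (∃ˢ (F g ⟨ # 1 , # 0 ⟩))) fibre-over-image empty-fibre)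
      where
      commutesˢ : [] ⊢ˢ compˢ P (F f) ⇔ˢ compˢ Q (F g)
      commutesˢ = mk commutes
      small-fˢ : _⊢ˢ_ {0} [] (∀ˢ (∃ˢ (∀ˢ (F f ⟨ # 0 , # 2 ⟩ ⇔ˢ # 0 ∈ˢ # 1))))
      small-fˢ = mk small-f
      -- a ↦ the x with p x = a and f' x = y, for the parameter y
      p⁻¹-in-fibre-functional :
        _⊢ˢ_ {1} [] (∀ˢ (∀ˢ (∀ˢ ((P ⟨ # 1 , # 2 ⟩ ∧ˢ Q ⟨ # 1 , # 3 ⟩) ∧ˢ (P ⟨ # 0 , # 2 ⟩ ∧ˢ Q ⟨ # 0 , # 3 ⟩)
                                 ⇒ˢ # 1 ≐ˢ # 0))))
      p⁻¹-in-fibre-functional =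
        ∀Iˢ (∀Iˢ (∀Iˢ (⇒Iˢ (apply jointly-monic ⟨ # 0 , # 1 ⟩ʳ
          (∃Iˢ (# 3) (∃Iˢ (# 2) (∧Iˢ (∧E₂ˢ (∧E₁ˢ (h 0))) (∧Iˢ (∧E₂ˢ (∧E₂ˢ (h 0)))
                                   (∧Iˢ (∧E₁ˢ (∧E₁ˢ (h 0))) (∧E₁ˢ (∧E₂ˢ (h 0))))))))))))
      fibre-over-image : (∃ˢ (F g ⟨ # 1 , # 0 ⟩) ∷ []) ⊢ˢ FibreIsSet
      fibre-over-image =
        ∃Eˢ (h 0) (∃Eˢ (∀Eˢ (apply₀ small-fˢ fromFin0) (# 0))
          (∃Eˢ (∀Eˢ (⇒Eˢ (∀Eˢ (replacementˢ (P ⟨ # 1 , # 0 ⟩ ∧ˢ Q ⟨ # 1 , # 2 ⟩)) (# 2))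
                          (apply₀ p⁻¹-in-fibre-functional (λ _ → # 2))) (# 0))
            (∃Iˢ (# 0) (∀Iˢ (∧Iˢ
              (⇒Iˢ (∃Eˢ (⇒Eˢ (∧E₂ˢ (apply₀ commutesˢ ⟨ # 0 , # 3 ⟩ʳ)) (∃Iˢ (# 4) (∧Iˢ (h 0) (h 3))))
                 (⇒Eˢ (∧E₂ˢ (∀Eˢ (h 2) (# 1)))
                      (∃Iˢ (# 0) (∧Iˢ (⇒Eˢ (∧E₁ˢ (∀Eˢ (h 3) (# 0))) (∧E₂ˢ (h 0))) (∧Iˢ (∧E₁ˢ (h 0)) (h 1)))))))
              (⇒Iˢ (∃Eˢ (⇒Eˢ (∧E₁ˢ (∀Eˢ (h 1) (# 0))) (h 0)) (∧E₂ˢ (∧E₂ˢ (h 0))))))))))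
      empty-fibre : (¬ˢ (∃ˢ (F g ⟨ # 1 , # 0 ⟩)) ∷ []) ⊢ˢ FibreIsSet
      empty-fibre =
        ∃Eˢ (∀Eˢ separation-⊥ (# 0)) (∃Iˢ (# 0) (∀Iˢ (∧Iˢ
          (⇒Iˢ (⊥Eˢ (⇒Eˢ (h 2) (apply (totalˢ g) (λ _ → # 2) (∧E₂ˢ (apply (typedˢ f') ⟨ # 0 , # 2 ⟩ʳ (h 0)))))))
          (⇒Iˢ (⊥Eˢ (∧E₂ˢ (⇒Eˢ (∧E₁ˢ (∀Eˢ (h 1) (# 0))) (h 0))))))))
        where
        separation-⊥ : ∀ {n} {Γ : List (Schema n)} → Γ ⊢ˢ ∀ˢ (∃ˢ (∀ˢ ((# 0 ∈ˢ # 1) ⇔ˢ (# 0 ∈ˢ # 2 ∧ˢ ⊥ˢ))))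
        separation-⊥ = mk (ax (ax-sep 0 ⊥'))

mainTheorem4 : {A B C D : Obj} (f : Hom A C) (g : Hom B C) (p : Hom D A) (f' : Hom D B) →
    IsPullback f g p f' → Small f → Small f'
mainTheorem4 f g p f' pb =
  small-if-jointly-monic {f = f} {g} {p} {f'} (IsPullback.commutes pb) (pullback-jointly-monic pb)
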